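{- Let $G$ be a cubic graph none of whose connected components is isomorphic to $K_4$, and let $v_1,v_2,v_3,v_4$ be vertices of $G$ that induce a diamond. Then for every partition $\mathcal{P}$ of $V(G)$ into nonempty parts, $u_{\mathcal{P}}(v_1)+u_{\mathcal{P}}(v_2)+u_{\mathcal{P}}(v_3)+u_{\mathcal{P}}(v_4)\le\frac54$.
   Context: A cubic graph has all degrees 3. A diamond is $K_4$ minus one edge. For $S\subseteq V$, $d(S)=|E(S)|/|S|$ with $E(S)$ the set of edges with both endpoints in $S$. For $P\subseteq V$ nonempty and $v\in P$, $u_P(v)=d(P)/|P|$; for a partition $\mathcal{P}$, $u_{\mathcal{P}}(v)=u_{P}(v)$ where $P\in\mathcal{P}$ contains $v$. -}

module Defs where

open import Data.Nat using (ℕ; zero; suc; _<ᵇ_)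
open import Data.Nat.ListAction using (sum)
open import Data.Bool using (Bool; true; false; if_then_else_; _∧_)
open import Data.Fin using (Fin; toℕ; _≟_)
open import Data.List using (List; map; allFin)
open import Data.Integer using (+_)
open import Data.Rational using (ℚ; 0ℚ; _/_; _*_)
open import Data.Product using (Σ; _×_)
open import Function.Bundles using (_⇔_)
open import Relation.Binary.PropositionalEquality using (_≡_; _≢_)
open import Relation.Nullary.Decidable using (⌊_⌋)

record Graph (n : ℕ) : Set where
  field
    adj    : Fin n → Fin n → Bool
    sym    : ∀ i j → adj i j ≡ adj j i
    irrefl : ∀ i → adj i i ≡ false
open Graph public

b2n : Bool → ℕ
b2n true  = 1
b2n false = 0

count : {n : ℕ} → (Fin n → Bool) → ℕ
count {n} p = sum (map (λ w → b2n (p w)) (allFin n))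

degree : {n : ℕ} → Graph n → Fin n → ℕ
degree G v = count (adj G v)

Cubic : {n : ℕ} → Graph n → Set
Cubic G = ∀ v → degree G v ≡ 3

Subset : ℕ → Set
Subset n = Fin n → Bool

size : {n : ℕ} → Subset n → ℕ
size S = count S

-- |E(S)|: number of edges {i,j} (counted once, via toℕ i < toℕ j) with both ends in S
edgesIn : {n : ℕ} → Graph n → Subset n → ℕ
edgesIn {n} G S =
  sum (map (λ i → sum (map (λ j → b2n (S i ∧ S j ∧ adj G i j ∧ (toℕ i <ᵇ toℕ j)))
                               (allFin n)))
           (allFin n))

-- a / b as a rational; the b = 0 case is never used (all sets considered are nonempty)
frac : ℕ → ℕ → ℚ
frac a zero    = 0ℚ
frac a (suc b) = (+ a) / suc b

density : {n : ℕ} → Graph n → Subset n → ℚ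
density G S = frac (edgesIn G S) (size S)

-- A partition of V(G) into nonempty parts is given by a labelling c : V → Fin n;
-- the parts are the (nonempty) fibres of c. Every such partition arises this way.
partOf : {n : ℕ} → (Fin n → Fin n) → Fin n → Subset n
partOf c v w = ⌊ c w ≟ c v ⌋

u : {n : ℕ} → Graph n → (Fin n → Fin n) → Fin n → ℚ
u G c v = density G (partOf c v) * frac 1 (size (partOf c v))

data Reach {n : ℕ} (G : Graph n) : Fin n → Fin n → Set where
  here : ∀ {i} → Reach G i i
  step : ∀ {i j k} → Reach G i j → adj G j k ≡ true → Reach G i k

ComponentIsK4 : {n : ℕ} → Graph n → Fin n → Set
ComponentIsK4 {n} G v =
  Σ (Fin n) λ a → Σ (Fin n) λ b → Σ (Fin n) λ c → Σ (Fin n) λ d →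
    (a ≢ b × a ≢ c × a ≢ d × b ≢ c × b ≢ d × c ≢ d) ×
    (∀ w → Reach G v w ⇔ ((w ≡ a) Data.Sum.⊎ (w ≡ b) Data.Sum.⊎ (w ≡ c) Data.Sum.⊎ (w ≡ d))) ×
    (adj G a b ≡ true × adj G a c ≡ true × adj G a d ≡ true ×
     adj G b c ≡ true × adj G b d ≡ true × adj G c d ≡ true)
  where import Data.Sum

-- v1,v2,v3,v4 are distinct and the induced subgraph has exactly 5 of the 6
-- possible edges, i.e. is K4 minus one edge (a diamond).
InducesDiamond : {n : ℕ} → Graph n → Fin n → Fin n → Fin n → Fin n → Set
InducesDiamond G v1 v2 v3 v4 =
  (v1 ≢ v2 × v1 ≢ v3 × v1 ≢ v4 × v2 ≢ v3 × v2 ≢ v4 × v3 ≢ v4) ×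
  (Data.Nat._+_ (b2n (adj G v1 v2))
   (Data.Nat._+_ (b2n (adj G v1 v3))
   (Data.Nat._+_ (b2n (adj G v1 v4))
   (Data.Nat._+_ (b2n (adj G v2 v3))
   (Data.Nat._+_ (b2n (adj G v2 v4)) (b2n (adj G v3 v4)))))) ≡ 5)
  where import Data.Nat

-- Let P be a part, w ∈ P and d the number of neighbours of w inside P. The handshake lemma, applied to P
-- and to P - w, gives 2|E(P)| ≤ 3(|P| - 1) + d and 2|E(P)| ≤ 2d + (|P| - 1)(|P| - 2); for small |P| the
-- second bound, for large |P| the first one yields u ≤ 1/3 on P as soon as some vertex of P has a neighbour
-- outside P, u ≤ 1/4 if some vertex has two, and u ≤ 5/16 if P contains two non-adjacent vertices.
-- Let a, b be the hubs (adjacent) and x, y the tips (non-adjacent) of the diamond. Each of the four gets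
-- 1/3: if its part misses a tip, the vertex itself or a hub in its part has a neighbour outside the part;
-- otherwise the part contains x and y. If all four lie in one part each gets 5/16; otherwise some of them
-- has two diamond neighbours outside its part and gets 1/4. Both totals are 5/4.

module Submission where

open import Defs hiding (sym)

module Combinatorics where

  open import Data.Nat using (ℕ; zero; suc; _+_; _*_; _∸_; _≤_; _<_; _<ᵇ_; _≤ᵇ_; ⌊_/2⌋; z≤n; s≤s)
  open import Data.Nat.Properties hiding (_≟_)
  open import Data.Nat.Tactic.RingSolver using (solve-∀)
  import Data.Nat.ListAction as List
  open import Data.Bool using (Bool; true; false; T; _∧_; not)
  open import Data.Bool.Properties using (∧-zeroʳ; ∧-identityʳ)
  open import Data.Fin using (Fin; zero; suc; toℕ; _≟_)
  open import Data.Fin.Properties using (toℕ-injective)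
  open import Data.List using (map; tabulate)
  open import Data.Vec using (Vec; []; _∷_)
  open import Data.Product using (_,_)
  open import Data.Empty using (⊥-elim)
  open import Function using (_∘_; id)
  open import Relation.Binary.PropositionalEquality
  open import Relation.Nullary using (yes; no; does)
  open import Relation.Nullary.Decidable using (dec-false)
  open import Algebra.Properties.Semiring.Sum +-*-semiring
    using (sum; sum-syntax; sum-cong-≗; sum-replicate-zero; ∑-distrib-+; ∑-comm; *-distribˡ-sum; *-distribʳ-sum)

  b2n-∧-≤ˡ : ∀ x y → b2n (x ∧ y) ≤ b2n x
  b2n-∧-≤ˡ false y     = z≤n
  b2n-∧-≤ˡ true  false = z≤n
  b2n-∧-≤ˡ true  true  = ≤-refl

  b2n-∧-≤ʳ : ∀ x y → b2n (x ∧ y) ≤ b2n y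
  b2n-∧-≤ʳ false y = z≤n
  b2n-∧-≤ʳ true  y = ≤-refl

  listSum-tabulate : ∀ {n} {A : Set} (f : A → ℕ) (g : Fin n → A) →
                     List.sum (map f (tabulate g)) ≡ ∑[ i < n ] f (g i)
  listSum-tabulate {zero}  f g = refl
  listSum-tabulate {suc n} f g = cong (f (g zero) +_) (listSum-tabulate f (g ∘ suc))

  count≡∑ : ∀ {n} (p : Fin n → Bool) → count p ≡ ∑[ j < n ] b2n (p j)
  count≡∑ p = listSum-tabulate (b2n ∘ p) id

  ∑-distrib-+₃ : ∀ {n} (f g h : Fin n → ℕ) → ∑[ i < n ] (f i + g i + h i) ≡ sum f + sum g + sum h
  ∑-distrib-+₃ f g h = trans (∑-distrib-+ (λ i → f i + g i) h) (cong (_+ sum h) (∑-distrib-+ f g))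

  ∑-mono-≤ : ∀ {n} {f g : Fin n → ℕ} → (∀ i → f i ≤ g i) → sum f ≤ sum g
  ∑-mono-≤ {zero}  f≤g = z≤n
  ∑-mono-≤ {suc n} f≤g = +-mono-≤ (f≤g zero) (∑-mono-≤ (f≤g ∘ suc))

  δ : ∀ {n} → Fin n → Fin n → ℕ
  δ z j = b2n (does (j ≟ z))

  δ-other : ∀ {n} {z j : Fin n} → j ≢ z → δ z j ≡ 0
  δ-other {z = z} {j} j≢z = cong b2n (dec-false (j ≟ z) j≢z)

  ∑-δ : ∀ {n} (z : Fin n) → ∑[ j < n ] δ z j ≡ 1
  ∑-δ {suc n} zero    = cong suc (sum-replicate-zero n)
  ∑-δ {suc n} (suc z) = ∑-δ z

  ∑-δ* : ∀ {n} (z : Fin n) k → ∑[ j < n ] (δ z j * k) ≡ k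
  ∑-δ* z k = trans (sym (*-distribʳ-sum k (δ z))) (trans (cong (_* k) (∑-δ z)) (*-identityˡ k))

  ∑-mono-≤-except : ∀ {n} (z : Fin n) {k l} {f g : Fin n → ℕ} →
           (∀ j → j ≢ z → f j ≤ g j) → f z + k ≤ g z + l → sum f + k ≤ sum g + l
  ∑-mono-≤-except {n} z {k} {l} {f} {g} off at = begin
    sum f + k                              ≡⟨ cong (sum f +_) (∑-δ* z k) ⟨
    sum f + ∑[ j < n ] (δ z j * k)         ≡⟨ ∑-distrib-+ f _ ⟨
    ∑[ j < n ] (f j + δ z j * k)           ≤⟨ ∑-mono-≤ pointwise ⟩
    ∑[ j < n ] (g j + δ z j * l)           ≡⟨ ∑-distrib-+ g _ ⟩
    sum g + ∑[ j < n ] (δ z j * l)         ≡⟨ cong (sum g +_) (∑-δ* z l) ⟩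
    sum g + l                              ∎
    where
    open ≤-Reasoning
    pointwise : ∀ j → f j + δ z j * k ≤ g j + δ z j * l
    pointwise j with j ≟ z
    ... | yes refl rewrite *-identityˡ k | *-identityˡ l = at
    ... | no j≢z   = +-monoˡ-≤ 0 (off j j≢z)

  ∑-mono-≤-except₂ : ∀ {n} {p q : Fin n} {f g : Fin n → ℕ} → p ≢ q →
            (∀ j → j ≢ p → j ≢ q → f j ≤ g j) → f p + 1 ≤ g p → f q + 1 ≤ g q → sum f + 2 ≤ sum g
  ∑-mono-≤-except₂ {n} {p} {q} {f} {g} p≢q off at-p at-q = begin
    sum f + 2                                 ≡⟨ cong (sum f +_) (cong₂ _+_ (∑-δ p) (∑-δ q)) ⟨
    sum f + (sum (δ p) + sum (δ q))           ≡⟨ cong (sum f +_) (∑-distrib-+ (δ p) (δ q)) ⟨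
    sum f + ∑[ j < n ] (δ p j + δ q j)        ≡⟨ ∑-distrib-+ f _ ⟨
    ∑[ j < n ] (f j + (δ p j + δ q j))        ≤⟨ ∑-mono-≤ pointwise ⟩
    sum g                                     ∎
    where
    open ≤-Reasoning
    pointwise : ∀ j → f j + (δ p j + δ q j) ≤ g j
    pointwise j with j ≟ p
    ... | yes refl rewrite δ-other p≢q = at-p
    ... | no j≢p with j ≟ q
    ...   | yes refl = at-q
    ...   | no j≢q   = subst (_≤ g j) (sym (+-identityʳ (f j))) (off j j≢p j≢q)

  ∣_∣ : ∀ {n} → Subset n → ℕ
  ∣_∣ {n} S = ∑[ j < n ] b2n (S j)

  _∖_ : ∀ {n} → Subset n → Fin n → Subset n
  (S ∖ w) j = S j ∧ not (does (j ≟ w))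

  ∣∣-∖ : ∀ {n} (S : Subset n) {w} → S w ≡ true → ∣ S ∣ ≡ suc ∣ S ∖ w ∣
  ∣∣-∖ {n} S {w} w∈S = begin
    ∣ S ∣                                        ≡⟨ sum-cong-≗ pointwise ⟩
    ∑[ j < n ] (b2n ((S ∖ w) j) + δ w j)        ≡⟨ ∑-distrib-+ _ (δ w) ⟩
    ∣ S ∖ w ∣ + sum (δ w)                        ≡⟨ cong (∣ S ∖ w ∣ +_) (∑-δ w) ⟩
    ∣ S ∖ w ∣ + 1                                ≡⟨ +-comm _ 1 ⟩
    suc ∣ S ∖ w ∣                                ∎
    where
    open ≡-Reasoning
    pointwise : ∀ j → b2n (S j) ≡ b2n ((S ∖ w) j) + δ w j
    pointwise j with j ≟ w
    ... | yes refl rewrite w∈S = refl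
    ... | no _     rewrite ∧-identityʳ (S j) = sym (+-identityʳ _)

  -- The numbers attached to a part S with a marked vertex w: e = |E(S)|, s = |S| = t + 1, D = degree of w
  -- in G[S], and rest = twice the number of edges of G[S - w].
  record EdgeBounds (e t D : ℕ) : Set where
    field
      rest        : ℕ
      split       : e + e ≡ rest + D + D
      rest-dense  : rest + t ≤ t * t
      deg≤t       : D ≤ t
      deg≤3       : D ≤ 3
      cubic-bound : e + e + 3 ≤ 3 * suc t + D

    e+e≤t²∸t+d+d : ∀ {d} → D ≤ d → e + e ≤ (t * t ∸ t) + d + d
    e+e≤t²∸t+d+d D≤d = begin
      e + e                ≡⟨ split ⟩
      rest + D + D         ≤⟨ +-mono-≤ (+-mono-≤ (m+n≤o⇒m≤o∸n rest rest-dense) D≤d) D≤d ⟩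
      (t * t ∸ t) + _ + _  ∎
      where open ≤-Reasoning

    e+e≤3s : e + e ≤ 3 * suc t
    e+e≤3s = +-cancelʳ-≤ 3 _ _ (≤-trans cubic-bound (+-monoʳ-≤ (3 * suc t) deg≤3))

  open EdgeBounds using (deg≤t; cubic-bound; e+e≤t²∸t+d+d; e+e≤3s)

  ≤-from-double : ∀ e q {m r} → e + e ≤ m → T (q * ⌊ m /2⌋ ≤ᵇ r) → q * e ≤ r
  ≤-from-double e q {m} e+e≤m q⌊m/2⌋≤r =
    ≤-trans (*-monoʳ-≤ q (subst (_≤ ⌊ m /2⌋) (sym (n≡⌊n+n/2⌋ e)) (⌊n/2⌋-mono e+e≤m))) (≤ᵇ⇒≤ _ _ q⌊m/2⌋≤r)

  ≤-quadratic : ∀ e {s} q p s₀ → s₀ ≤ s → T (3 * q ≤ᵇ 2 * p * s₀) → e + e ≤ 3 * s → q * e ≤ p * (s * s)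
  ≤-quadratic e {s} q p s₀ s₀≤s 3q≤2ps₀ e+e≤3s = *-cancelˡ-≤ 2 (begin
    2 * (q * e)        ≡⟨ lhs q e ⟩
    q * (e + e)        ≤⟨ *-monoʳ-≤ q e+e≤3s ⟩
    q * (3 * s)        ≡⟨ middle q s ⟩
    3 * q * s          ≤⟨ *-monoˡ-≤ s (≤-trans (≤ᵇ⇒≤ (3 * q) (2 * p * s₀) 3q≤2ps₀) (*-monoʳ-≤ (2 * p) s₀≤s)) ⟩
    2 * p * s * s      ≡⟨ rhs p s ⟩
    2 * (p * (s * s))  ∎)
    where
    open ≤-Reasoning
    lhs : ∀ q e → 2 * (q * e) ≡ q * (e + e)
    lhs = solve-∀
    middle : ∀ q s → q * (3 * s) ≡ 3 * q * s
    middle = solve-∀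
    rhs : ∀ p s → 2 * p * s * s ≡ 2 * (p * (s * s))
    rhs = solve-∀

  e≤s²/3 : ∀ {e t D} → EdgeBounds e t D → D ≤ 2 → 3 * e ≤ 1 * (suc t * suc t)
  e≤s²/3 {e} {t = 0} b _   = ≤-from-double e 3 (e+e≤t²∸t+d+d b (deg≤t b)) _
  e≤s²/3 {e} {t = 1} b _   = ≤-from-double e 3 (e+e≤t²∸t+d+d b (deg≤t b)) _
  e≤s²/3 {e} {t = 2} b D≤2 = ≤-from-double e 3 (e+e≤t²∸t+d+d b D≤2) _
  e≤s²/3 {e} {t = 3} b D≤2 = ≤-from-double e 3 (e+e≤t²∸t+d+d b D≤2) _
  e≤s²/3 {e} {t = suc (suc (suc (suc t)))} b _ = ≤-quadratic e 3 1 5 (m≤m+n 5 t) _ (e+e≤3s b)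

  e≤s²/4 : ∀ {e t D} → EdgeBounds e t D → D ≤ 1 → 4 * e ≤ 1 * (suc t * suc t)
  e≤s²/4 {e} {t = 0} b _   = ≤-from-double e 4 (e+e≤t²∸t+d+d b (deg≤t b)) _
  e≤s²/4 {e} {t = 1} b D≤1 = ≤-from-double e 4 (e+e≤t²∸t+d+d b D≤1) _
  e≤s²/4 {e} {t = 2} b D≤1 = ≤-from-double e 4 (e+e≤t²∸t+d+d b D≤1) _
  e≤s²/4 {e} {t = 3} b D≤1 = ≤-from-double e 4 (e+e≤t²∸t+d+d b D≤1) _
  e≤s²/4 {e} {t = 4} b D≤1 =
    ≤-from-double e 4 (m+n≤o⇒m≤o∸n (e + e) (≤-trans (cubic-bound b) (+-monoʳ-≤ 15 D≤1))) _
  e≤s²/4 {e} {t = suc (suc (suc (suc (suc t))))} b _ = ≤-quadratic e 4 1 6 (m≤m+n 6 t) _ (e+e≤3s b)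

  e≤5s²/16 : ∀ {e t D} → EdgeBounds e t D → D + 2 ≤ suc t → 16 * e ≤ 5 * (suc t * suc t)
  e≤5s²/16 {e} {t = 0} b _     = ≤-from-double e 16 (e+e≤t²∸t+d+d b (deg≤t b)) _
  e≤5s²/16 {e} {t = 1} b D+2≤s = ≤-from-double e 16 (e+e≤t²∸t+d+d b (m+n≤o⇒m≤o∸n _ D+2≤s)) _
  e≤5s²/16 {e} {t = 2} b D+2≤s = ≤-from-double e 16 (e+e≤t²∸t+d+d b (m+n≤o⇒m≤o∸n _ D+2≤s)) _
  e≤5s²/16 {e} {t = 3} b D+2≤s = ≤-from-double e 16 (e+e≤t²∸t+d+d b (m+n≤o⇒m≤o∸n _ D+2≤s)) _
  e≤5s²/16 {e} {t = suc (suc (suc (suc t)))} b _ = ≤-quadratic e 16 5 5 (m≤m+n 5 t) _ (e+e≤3s b)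

  b2n≤1 : ∀ b → b2n b ≤ 1
  b2n≤1 false = z≤n
  b2n≤1 true  = ≤-refl

  ones : ∀ {k} → Vec Bool (suc k) → ℕ
  ones (b ∷ [])     = b2n b
  ones (b ∷ c ∷ bs) = b2n b + ones (c ∷ bs)

  ones≤ : ∀ {k} (bs : Vec Bool (suc k)) → ones bs ≤ suc k
  ones≤ (b ∷ [])     = b2n≤1 b
  ones≤ (b ∷ c ∷ bs) = +-mono-≤ (b2n≤1 b) (ones≤ (c ∷ bs))

  ones≢ : ∀ {k m} j (bs : Vec Bool (suc k)) → j + ones bs ≢ j + (suc k + suc m)
  ones≢ {k} j bs eq = ≤⇒≯ (ones≤ bs) (subst (suc k <_) (sym (+-cancelˡ-≡ j _ _ eq)) (m<m+n (suc k) (s≤s z≤n)))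

  data OneMissing : Bool → Bool → Bool → Bool → Bool → Bool → Set where
    missing₁₂ : OneMissing false true  true  true  true  true
    missing₁₃ : OneMissing true  false true  true  true  true
    missing₁₄ : OneMissing true  true  false true  true  true
    missing₂₃ : OneMissing true  true  true  false true  true
    missing₂₄ : OneMissing true  true  true  true  false true
    missing₃₄ : OneMissing true  true  true  true  true  false

  -- Unlisted assignments are refuted by evaluating the sum; in the last ten it is stuck on unknown bits.
  one-missing : ∀ b₁₂ b₁₃ b₁₄ b₂₃ b₂₄ b₃₄ → b2n b₁₂ + (b2n b₁₃ + (b2n b₁₄ + (b2n b₂₃ + (b2n b₂₄ + b2n b₃₄)))) ≡ 5 →
                OneMissing b₁₂ b₁₃ b₁₄ b₂₃ b₂₄ b₃₄
  one-missing false true  true  true  true  true  refl = missing₁₂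
  one-missing true  false true  true  true  true  refl = missing₁₃
  one-missing true  true  false true  true  true  refl = missing₁₄
  one-missing true  true  true  false true  true  refl = missing₂₃
  one-missing true  true  true  true  false true  refl = missing₂₄
  one-missing true  true  true  true  true  false refl = missing₃₄
  one-missing false false c     d     e     f     h = ⊥-elim (ones≢ 0 (c ∷ d ∷ e ∷ f ∷ []) h)
  one-missing false true  false d     e     f     h = ⊥-elim (ones≢ 1 (d ∷ e ∷ f ∷ []) h)
  one-missing false true  true  false e     f     h = ⊥-elim (ones≢ 2 (e ∷ f ∷ []) h)
  one-missing false true  true  true  false f     h = ⊥-elim (ones≢ 3 (f ∷ []) h)
  one-missing true  false false d     e     f     h = ⊥-elim (ones≢ 1 (d ∷ e ∷ f ∷ []) h)
  one-missing true  false true  false e     f     h = ⊥-elim (ones≢ 2 (e ∷ f ∷ []) h)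
  one-missing true  false true  true  false f     h = ⊥-elim (ones≢ 3 (f ∷ []) h)
  one-missing true  true  false false e     f     h = ⊥-elim (ones≢ 2 (e ∷ f ∷ []) h)
  one-missing true  true  false true  false f     h = ⊥-elim (ones≢ 3 (f ∷ []) h)
  one-missing true  true  true  false false f     h = ⊥-elim (ones≢ 3 (f ∷ []) h)

  record Diamond {n} (G : Graph n) (a b x y : Fin n) : Set where
    constructor diamond
    field
      a~b : adj G a b ≡ true
      a~x : adj G a x ≡ true
      a~y : adj G a y ≡ true
      b~x : adj G b x ≡ true
      b~y : adj G b y ≡ true
      x≁y : adj G x y ≡ false
      x≢y : x ≢ y

  data DiamondLabelling {n} (G : Graph n) (v₁ v₂ v₃ v₄ : Fin n) : Set where
    tips₁₂ : Diamond G v₃ v₄ v₁ v₂ → DiamondLabelling G v₁ v₂ v₃ v₄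
    tips₁₃ : Diamond G v₂ v₄ v₁ v₃ → DiamondLabelling G v₁ v₂ v₃ v₄
    tips₁₄ : Diamond G v₂ v₃ v₁ v₄ → DiamondLabelling G v₁ v₂ v₃ v₄
    tips₂₃ : Diamond G v₁ v₄ v₂ v₃ → DiamondLabelling G v₁ v₂ v₃ v₄
    tips₂₄ : Diamond G v₁ v₃ v₂ v₄ → DiamondLabelling G v₁ v₂ v₃ v₄
    tips₃₄ : Diamond G v₁ v₂ v₃ v₄ → DiamondLabelling G v₁ v₂ v₃ v₄

  module _ {n : ℕ} (G : Graph n) where

    adjIn : Subset n → Fin n → Fin n → Bool
    adjIn S i j = S i ∧ S j ∧ adj G i j

    degIn : Subset n → Fin n → ℕ
    degIn S i = ∑[ j < n ] b2n (adjIn S i j)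

    degreeSum : Subset n → ℕ
    degreeSum S = ∑[ i < n ] degIn S i

    adj-≢ : ∀ {i j} → adj G i j ≡ true → i ≢ j
    adj-≢ {i} i~j refl with trans (sym i~j) (irrefl G i)
    ... | ()

    adjIn-sym : ∀ S i j → adjIn S i j ≡ adjIn S j i
    adjIn-sym S i j rewrite Graph.sym G i j with S i | S j
    ... | false | false = refl
    ... | false | true  = refl
    ... | true  | false = refl
    ... | true  | true  = refl

    degIn-∉ : ∀ S i → S i ≡ false → degIn S i ≡ 0
    degIn-∉ S i i∉S =
      trans (sum-cong-≗ (λ j → cong (λ b → b2n (b ∧ S j ∧ adj G i j)) i∉S)) (sum-replicate-zero n)

    ∑adj≡3 : Cubic G → ∀ i → ∑[ j < n ] b2n (adj G i j) ≡ 3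
    ∑adj≡3 cubic i = trans (sym (count≡∑ (adj G i))) (cubic i)

    degIn≤∑adj : ∀ S i → degIn S i ≤ ∑[ j < n ] b2n (adj G i j)
    degIn≤∑adj S i = ∑-mono-≤ (λ j → ≤-trans (b2n-∧-≤ʳ (S i) _) (b2n-∧-≤ʳ (S j) _))

    degIn≤3 : Cubic G → ∀ S i → degIn S i ≤ 3
    degIn≤3 cubic S i = subst (degIn S i ≤_) (∑adj≡3 cubic i) (degIn≤∑adj S i)

    degIn≤3*b2n : Cubic G → ∀ S i → degIn S i ≤ 3 * b2n (S i)
    degIn≤3*b2n cubic S i = bound (S i) refl
      where
      bound : ∀ b → S i ≡ b → degIn S i ≤ 3 * b2n b
      bound true  _   = degIn≤3 cubic S i
      bound false i∉S = ≤-reflexive (degIn-∉ S i i∉S)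

    degIn<∣∣ : ∀ {S i} → S i ≡ true → degIn S i + 1 ≤ ∣ S ∣
    degIn<∣∣ {S} {i} i∈S = subst (degIn S i + 1 ≤_) (+-identityʳ ∣ S ∣) (∑-mono-≤-except i off at)
      where
      off : ∀ j → j ≢ i → b2n (adjIn S i j) ≤ b2n (S j)
      off j _ = ≤-trans (b2n-∧-≤ʳ (S i) _) (b2n-∧-≤ˡ (S j) _)
      at : b2n (S i ∧ S i ∧ adj G i i) + 1 ≤ b2n (S i) + 0
      at rewrite i∈S | irrefl G i = ≤-refl

    degreeSum-dense : ∀ S → degreeSum S + ∣ S ∣ ≤ ∣ S ∣ * ∣ S ∣
    degreeSum-dense S = begin
      degreeSum S + ∣ S ∣                    ≡⟨ ∑-distrib-+ (degIn S) _ ⟨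
      ∑[ i < n ] (degIn S i + b2n (S i))     ≤⟨ ∑-mono-≤ (λ i → bound i (S i) refl) ⟩
      ∑[ i < n ] (b2n (S i) * ∣ S ∣)         ≡⟨ *-distribʳ-sum ∣ S ∣ (b2n ∘ S) ⟨
      ∣ S ∣ * ∣ S ∣                          ∎
      where
      open ≤-Reasoning
      bound : ∀ i b → S i ≡ b → degIn S i + b2n b ≤ b2n b * ∣ S ∣
      bound i true  i∈S = subst (degIn S i + 1 ≤_) (sym (*-identityˡ ∣ S ∣)) (degIn<∣∣ i∈S)
      bound i false i∉S = ≤-reflexive (trans (+-identityʳ _) (degIn-∉ S i i∉S))

    degreeSum-cubic : Cubic G → ∀ {S w} → S w ≡ true → degreeSum S + 3 ≤ 3 * ∣ S ∣ + degIn S w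
    degreeSum-cubic cubic {S} {w} w∈S =
      subst (λ m → degreeSum S + 3 ≤ m + degIn S w) (sym (*-distribˡ-sum 3 (b2n ∘ S)))
            (∑-mono-≤-except w (λ i _ → degIn≤3*b2n cubic S i) at)
      where
      at : degIn S w + 3 ≤ 3 * b2n (S w) + degIn S w
      at rewrite w∈S = ≤-reflexive (+-comm _ 3)

    adjIn-∖ : ∀ S {w} → S w ≡ true → ∀ i j →
              b2n (adjIn S i j) ≡ b2n (adjIn (S ∖ w) i j) + δ w j * b2n (adjIn S i w) + δ w i * b2n (adjIn S w j)
    adjIn-∖ S {w} w∈S i j with i ≟ w
    ... | yes refl with j ≟ w
    ...   | yes refl rewrite w∈S | irrefl G w = refl
    ...   | no _     rewrite w∈S = sym (*-identityˡ _)
    adjIn-∖ S {w} w∈S i j | no _ with j ≟ w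
    ...   | yes refl rewrite w∈S | ∧-identityʳ (S i) | ∧-zeroʳ (S i) =
      sym (trans (+-identityʳ _) (+-identityʳ _))
    ...   | no _     rewrite ∧-identityʳ (S i) | ∧-identityʳ (S j) =
      sym (trans (+-identityʳ _) (+-identityʳ _))

    degreeSum-∖ : ∀ {S w} → S w ≡ true → degreeSum S ≡ degreeSum (S ∖ w) + degIn S w + degIn S w
    degreeSum-∖ {S} {w} w∈S = begin
      degreeSum S
        ≡⟨ sum-cong-≗ (λ i → trans (sum-cong-≗ (adjIn-∖ S w∈S i)) (row i)) ⟩
      ∑[ i < n ] (degIn (S ∖ w) i + b2n (adjIn S i w) + δ w i * degIn S w)
        ≡⟨ ∑-distrib-+₃ (degIn (S ∖ w)) (λ i → b2n (adjIn S i w)) (λ i → δ w i * degIn S w) ⟩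
      degreeSum (S ∖ w) + ∑[ i < n ] b2n (adjIn S i w) + ∑[ i < n ] (δ w i * degIn S w)
        ≡⟨ cong₂ (λ x y → degreeSum (S ∖ w) + x + y) column (∑-δ* w (degIn S w)) ⟩
      degreeSum (S ∖ w) + degIn S w + degIn S w
        ∎
      where
      open ≡-Reasoning
      row : ∀ i → ∑[ j < n ] (b2n (adjIn (S ∖ w) i j) + δ w j * b2n (adjIn S i w) + δ w i * b2n (adjIn S w j))
                  ≡ degIn (S ∖ w) i + b2n (adjIn S i w) + δ w i * degIn S w
      row i = trans (∑-distrib-+₃ (λ j → b2n (adjIn (S ∖ w) i j)) (λ j → δ w j * b2n (adjIn S i w))
                                  (λ j → δ w i * b2n (adjIn S w j)))
                    (cong₂ (λ x y → degIn (S ∖ w) i + x + y)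
                           (∑-δ* w _) (sym (*-distribˡ-sum (δ w i) (λ j → b2n (adjIn S w j)))))
      column : ∑[ i < n ] b2n (adjIn S i w) ≡ degIn S w
      column = sum-cong-≗ (λ i → cong b2n (adjIn-sym S i w))

    -- edgesIn counts an edge only at its endpoint of smaller index; the transposed count supplies the other.
    handshake : ∀ S → edgesIn G S + edgesIn G S ≡ degreeSum S
    handshake S = begin
      edgesIn G S + edgesIn G S
        ≡⟨ cong₂ _+_ edgesIn≡∑ (trans edgesIn≡∑ (∑-comm ordered)) ⟩
      ∑[ i < n ] ∑[ j < n ] ordered i j + ∑[ i < n ] ∑[ j < n ] ordered j i
        ≡⟨ ∑-distrib-+ (λ i → ∑[ j < n ] ordered i j) (λ i → ∑[ j < n ] ordered j i) ⟨
      ∑[ i < n ] (∑[ j < n ] ordered i j + ∑[ j < n ] ordered j i)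
        ≡⟨ sum-cong-≗ (λ i → trans (sym (∑-distrib-+ (ordered i) (λ j → ordered j i)))
                                   (sum-cong-≗ (ordered-both i))) ⟩
      degreeSum S
        ∎
      where
      open ≡-Reasoning
      ordered : Fin n → Fin n → ℕ
      ordered i j = b2n (S i ∧ S j ∧ adj G i j ∧ (toℕ i <ᵇ toℕ j))
      edgesIn≡∑ : edgesIn G S ≡ ∑[ i < n ] ∑[ j < n ] ordered i j
      edgesIn≡∑ = trans (listSum-tabulate (λ i → List.sum (map (ordered i) (tabulate id))) id)
                        (sum-cong-≗ (λ i → listSum-tabulate (ordered i) id))
      <ᵇ-either : ∀ m k → m ≢ k → b2n (m <ᵇ k) + b2n (k <ᵇ m) ≡ 1
      <ᵇ-either zero    zero    m≢k = ⊥-elim (m≢k refl)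
      <ᵇ-either zero    (suc k) _   = refl
      <ᵇ-either (suc m) zero    _   = refl
      <ᵇ-either (suc m) (suc k) m≢k = <ᵇ-either m k (m≢k ∘ cong suc)
      ordered-both : ∀ i j → ordered i j + ordered j i ≡ b2n (adjIn S i j)
      ordered-both i j rewrite Graph.sym G j i with S i | S j
      ... | false | false = refl
      ... | false | true  = refl
      ... | true  | false = refl
      ... | true  | true  with adj G i j in i~j
      ...   | false = refl
      ...   | true  = <ᵇ-either (toℕ i) (toℕ j) (adj-≢ i~j ∘ toℕ-injective)

    degIn-outside : Cubic G → ∀ {S w z} → S w ≡ true → adj G w z ≡ true → S z ≡ false → degIn S w + 1 ≤ 3
    degIn-outside cubic {S} {w} {z} w∈S w~z z∉S =
      subst (degIn S w + 1 ≤_) (trans (+-identityʳ _) (∑adj≡3 cubic w)) (∑-mono-≤-except z off at)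
      where
      off : ∀ j → j ≢ z → b2n (adjIn S w j) ≤ b2n (adj G w j)
      off j _ = ≤-trans (b2n-∧-≤ʳ (S w) _) (b2n-∧-≤ʳ (S j) _)
      at : b2n (S w ∧ S z ∧ adj G w z) + 1 ≤ b2n (adj G w z) + 0
      at rewrite w∈S | z∉S | w~z = ≤-refl

    degIn-outside₂ : Cubic G → ∀ {S w p q} → S w ≡ true → p ≢ q → adj G w p ≡ true → adj G w q ≡ true →
                     S p ≡ false → S q ≡ false → degIn S w + 2 ≤ 3
    degIn-outside₂ cubic {S} {w} {p} {q} w∈S p≢q w~p w~q p∉S q∉S =
      subst (degIn S w + 2 ≤_) (∑adj≡3 cubic w) (∑-mono-≤-except₂ p≢q off at-p at-q)
      where
      off : ∀ j → j ≢ p → j ≢ q → b2n (adjIn S w j) ≤ b2n (adj G w j)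
      off j _ _ = ≤-trans (b2n-∧-≤ʳ (S w) _) (b2n-∧-≤ʳ (S j) _)
      at-p : b2n (S w ∧ S p ∧ adj G w p) + 1 ≤ b2n (adj G w p)
      at-p rewrite w∈S | p∉S | w~p = ≤-refl
      at-q : b2n (S w ∧ S q ∧ adj G w q) + 1 ≤ b2n (adj G w q)
      at-q rewrite w∈S | q∉S | w~q = ≤-refl

    degIn-nonadjacent : ∀ {S w z} → S w ≡ true → S z ≡ true → w ≢ z → adj G w z ≡ false → degIn S w + 2 ≤ ∣ S ∣
    degIn-nonadjacent {S} {w} {z} w∈S z∈S w≢z w≁z = ∑-mono-≤-except₂ w≢z off at-w at-z
      where
      off : ∀ j → j ≢ w → j ≢ z → b2n (adjIn S w j) ≤ b2n (S j)
      off j _ _ = ≤-trans (b2n-∧-≤ʳ (S w) _) (b2n-∧-≤ˡ (S j) _)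
      at-w : b2n (S w ∧ S w ∧ adj G w w) + 1 ≤ b2n (S w)
      at-w rewrite w∈S | irrefl G w = ≤-refl
      at-z : b2n (S w ∧ S z ∧ adj G w z) + 1 ≤ b2n (S z)
      at-z rewrite w∈S | z∈S | w≁z = ≤-refl

    edgeBounds : Cubic G → ∀ {S w} → S w ≡ true → EdgeBounds (edgesIn G S) ∣ S ∖ w ∣ (degIn S w)
    edgeBounds cubic {S} {w} w∈S = record
      { rest        = degreeSum (S ∖ w)
      ; split       = trans (handshake S) (degreeSum-∖ {S} w∈S)
      ; rest-dense  = degreeSum-dense (S ∖ w)
      ; deg≤t       = m+n≤o⇒m≤o∸n (degIn S w) (subst (degIn S w + 1 ≤_) (∣∣-∖ S w∈S) (degIn<∣∣ {S} w∈S))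
      ; deg≤3       = degIn≤3 cubic S w
      ; cubic-bound = subst₂ (λ x y → x + 3 ≤ 3 * y + degIn S w) (sym (handshake S)) (∣∣-∖ S w∈S)
                             (degreeSum-cubic cubic {S} w∈S)
      }

    adj-flip : ∀ {i j b} → adj G i j ≡ b → adj G j i ≡ b
    adj-flip {i} {j} i~j = trans (Graph.sym G j i) i~j

    diamond-labelling : ∀ {v₁ v₂ v₃ v₄} → InducesDiamond G v₁ v₂ v₃ v₄ → DiamondLabelling G v₁ v₂ v₃ v₄
    diamond-labelling {v₁} {v₂} {v₃} {v₄} ((d₁₂ , d₁₃ , d₁₄ , d₂₃ , d₂₄ , d₃₄) , five)
      with adj G v₁ v₂ in e₁₂ | adj G v₁ v₃ in e₁₃ | adj G v₁ v₄ in e₁₄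
         | adj G v₂ v₃ in e₂₃ | adj G v₂ v₄ in e₂₄ | adj G v₃ v₄ in e₃₄
         | one-missing (adj G v₁ v₂) (adj G v₁ v₃) (adj G v₁ v₄) (adj G v₂ v₃) (adj G v₂ v₄) (adj G v₃ v₄) five
    ... | _ | _ | _ | _ | _ | _ | missing₁₂ =
      tips₁₂ (diamond e₃₄ (adj-flip e₁₃) (adj-flip e₂₃) (adj-flip e₁₄) (adj-flip e₂₄) e₁₂ d₁₂)
    ... | _ | _ | _ | _ | _ | _ | missing₁₃ =
      tips₁₃ (diamond e₂₄ (adj-flip e₁₂) e₂₃ (adj-flip e₁₄) (adj-flip e₃₄) e₁₃ d₁₃)
    ... | _ | _ | _ | _ | _ | _ | missing₁₄ =
      tips₁₄ (diamond e₂₃ (adj-flip e₁₂) e₂₄ (adj-flip e₁₃) e₃₄ e₁₄ d₁₄)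
    ... | _ | _ | _ | _ | _ | _ | missing₂₃ =
      tips₂₃ (diamond e₁₄ e₁₂ e₁₃ (adj-flip e₂₄) (adj-flip e₃₄) e₂₃ d₂₃)
    ... | _ | _ | _ | _ | _ | _ | missing₂₄ =
      tips₂₄ (diamond e₁₃ e₁₂ e₁₄ (adj-flip e₂₃) e₃₄ e₂₄ d₂₄)
    ... | _ | _ | _ | _ | _ | _ | missing₃₄ =
      tips₃₄ (diamond e₁₂ e₁₃ e₁₄ e₂₃ e₂₄ e₃₄ d₃₄)

module Density where

  open import Data.Nat using (suc; _+_; _*_; _≤_; NonZero)
  open import Data.Nat.Properties using (*-comm; *-identityʳ; m+n≤o⇒m≤o∸n)
  open import Data.Bool using (true; false)
  open import Data.Fin using (Fin; _≟_)
  open import Data.Integer as ℤ using (+_)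
  open import Data.Integer.Properties using (pos-*)
  import Data.Rational as ℚ
  open import Data.Rational.Properties using (toℚᵘ-fromℚᵘ; toℚᵘ-cancel-≤; toℚᵘ-homo-*)
  import Data.Rational.Unnormalised as ℚᵘ
  import Data.Rational.Unnormalised.Properties as ℚᵘ
  open import Relation.Binary.PropositionalEquality
  open import Relation.Nullary using (yes; no)
  open import Data.Empty using (⊥-elim)
  open Combinatorics

  frac-sq-≤ : ∀ {e s t p d} .{{_ : NonZero d}} → s ≡ suc t → d * e ≤ p * (suc t * suc t) →
              frac e s ℚ.* frac 1 s ℚ.≤ + p ℚ./ d
  frac-sq-≤ {e} {t = t} {p} {suc q} refl d*e≤p*s² = toℚᵘ-cancel-≤ (begin
    ℚ.toℚᵘ (frac e (suc t) ℚ.* frac 1 (suc t))       ≃⟨ toℚᵘ-homo-* (frac e (suc t)) (frac 1 (suc t)) ⟩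
    ℚ.toℚᵘ (frac e (suc t)) ℚᵘ.* ℚ.toℚᵘ (frac 1 (suc t))
      ≃⟨ ℚᵘ.*-cong (toℚᵘ-fromℚᵘ (ℚᵘ.mkℚᵘ (+ e) t)) (toℚᵘ-fromℚᵘ (ℚᵘ.mkℚᵘ (+ 1) t)) ⟩
    ℚᵘ.mkℚᵘ (+ e) t ℚᵘ.* ℚᵘ.mkℚᵘ (+ 1) t              ≤⟨ ℚᵘ.*≤* cross ⟩
    ℚᵘ.mkℚᵘ (+ p) q                                  ≃⟨ toℚᵘ-fromℚᵘ (ℚᵘ.mkℚᵘ (+ p) q) ⟨
    ℚ.toℚᵘ (+ p ℚ./ suc q)                           ∎)
    where
    open ℚᵘ.≤-Reasoning
    cross : (+ e ℤ.* + 1) ℤ.* + suc q ℤ.≤ + p ℤ.* (+ suc t ℤ.* + suc t)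
    cross rewrite sym (pos-* e 1) | sym (pos-* (e * 1) (suc q)) | sym (pos-* (suc t) (suc t))
                | sym (pos-* p (suc t * suc t)) | *-identityʳ e =
      ℤ.+≤+ (subst (_≤ p * (suc t * suc t)) (*-comm (suc q) e) d*e≤p*s²)

  module Parts {n} {G : Graph n} (cubic : Cubic G) (c : Fin n → Fin n) where

    ∈-part : ∀ {v w} → c w ≡ c v → partOf c v w ≡ true
    ∈-part {v} {w} w∈P with c w ≟ c v
    ... | yes _   = refl
    ... | no w∉P = ⊥-elim (w∉P w∈P)

    ∉-part : ∀ {v w} → c w ≢ c v → partOf c v w ≡ false
    ∉-part {v} {w} w∉P with c w ≟ c v
    ... | yes w∈P = ⊥-elim (w∉P w∈P)
    ... | no _    = refl

    u-≤ : ∀ {v w} p d .{{_ : NonZero d}} → c w ≡ c v → let P = partOf c v ; t = ∣ P ∖ w ∣ in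
          (∀ {e} → EdgeBounds e t (degIn G P w) → d * e ≤ p * (suc t * suc t)) → u G c v ℚ.≤ + p ℚ./ d
    u-≤ {v} {w} p d w∈P bound =
      frac-sq-≤ {p = p} {d = d} (trans (count≡∑ P) (∣∣-∖ P w∈P′)) (bound (edgeBounds G cubic {P} w∈P′))
      where
      P = partOf c v
      w∈P′ = ∈-part {v} {w} w∈P

    u-≤-⅓ : ∀ v {w z} → c w ≡ c v → adj G w z ≡ true → c z ≢ c v → u G c v ℚ.≤ + 1 ℚ./ 3
    u-≤-⅓ v {w} {z} w∈P w~z z∉P = u-≤ 1 3 w∈P λ b →
      e≤s²/3 b (m+n≤o⇒m≤o∸n _ (degIn-outside G cubic (∈-part {v} w∈P) w~z (∉-part {v} {z} z∉P)))

    u-≤-¼ : ∀ v {w p q} → c w ≡ c v → p ≢ q → adj G w p ≡ true → adj G w q ≡ true → c p ≢ c v → c q ≢ c v →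
            u G c v ℚ.≤ + 1 ℚ./ 4
    u-≤-¼ v {w} {p} {q} w∈P p≢q w~p w~q p∉P q∉P = u-≤ 1 4 w∈P λ b →
      e≤s²/4 b (m+n≤o⇒m≤o∸n _ (degIn-outside₂ G cubic (∈-part {v} w∈P) p≢q w~p w~q
                                                (∉-part {v} {p} p∉P) (∉-part {v} {q} q∉P)))

    u-≤-5/16 : ∀ v {w z} → c w ≡ c v → c z ≡ c v → w ≢ z → adj G w z ≡ false → u G c v ℚ.≤ + 5 ℚ./ 16
    u-≤-5/16 v {w} {z} w∈P z∈P w≢z w≁z = u-≤ 5 16 w∈P λ b →
      e≤5s²/16 b (subst (degIn G P w + 2 ≤_) (∣∣-∖ P (∈-part {v} w∈P))
                        (degIn-nonadjacent G (∈-part {v} w∈P) (∈-part {v} {z} z∈P) w≢z w≁z))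
      where P = partOf c v

open import Data.Nat using (ℕ)
open import Data.Bool using (true; false)
open import Data.Fin using (Fin; _≟_)
open import Data.Integer using (+_)
open import Data.Rational using (_/_; _+_; _≤_)
open import Data.Rational.Properties using (≤-trans; +-mono-≤; ≤ᵇ⇒≤)
open import Data.Rational.Solver using (module +-*-Solver)
open import Function using (_∘_)
open import Relation.Binary.PropositionalEquality using (_≡_; _≢_; refl; sym; trans; subst)
open import Relation.Nullary using (¬_; Dec; yes; no)
open Combinatorics
  using (Diamond; diamond; DiamondLabelling; diamond-labelling; tips₁₂; tips₁₃; tips₁₄; tips₂₃; tips₂₄; tips₃₄;
         adj-flip; adj-≢)

5/16≤1/3 : + 5 / 16 ≤ + 1 / 3
5/16≤1/3 = ≤ᵇ⇒≤ _

+-mono₄-≤ : ∀ {p₁ p₂ p₃ p₄ q₁ q₂ q₃ q₄} → p₁ ≤ q₁ → p₂ ≤ q₂ → p₃ ≤ q₃ → p₄ ≤ q₄ →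
            p₁ + p₂ + p₃ + p₄ ≤ q₁ + q₂ + q₃ + q₄
+-mono₄-≤ h₁ h₂ h₃ h₄ = +-mono-≤ (+-mono-≤ (+-mono-≤ h₁ h₂) h₃) h₄

module _ where
  open +-*-Solver

  abxy≡xyab : ∀ a b x y → a + b + x + y ≡ x + y + a + b
  abxy≡xyab = solve 4 (λ a b x y → a :+ b :+ x :+ y := x :+ y :+ a :+ b) refl

  abxy≡xayb : ∀ a b x y → a + b + x + y ≡ x + a + y + b
  abxy≡xayb = solve 4 (λ a b x y → a :+ b :+ x :+ y := x :+ a :+ y :+ b) refl

  abxy≡xaby : ∀ a b x y → a + b + x + y ≡ x + a + b + y
  abxy≡xaby = solve 4 (λ a b x y → a :+ b :+ x :+ y := x :+ a :+ b :+ y) refl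

  abxy≡axyb : ∀ a b x y → a + b + x + y ≡ a + x + y + b
  abxy≡axyb = solve 4 (λ a b x y → a :+ b :+ x :+ y := a :+ x :+ y :+ b) refl

  abxy≡axby : ∀ a b x y → a + b + x + y ≡ a + x + b + y
  abxy≡axby = solve 4 (λ a b x y → a :+ b :+ x :+ y := a :+ x :+ b :+ y) refl

module _ {n} {G : Graph n} (cubic : Cubic G) (c : Fin n → Fin n) where

  open Density.Parts {G = G} cubic c using (u-≤-⅓; u-≤-¼; u-≤-5/16)

  hub-≤-⅓ : ∀ {v x y} → adj G v x ≡ true → adj G v y ≡ true → x ≢ y → adj G x y ≡ false → u G c v ≤ + 1 / 3
  hub-≤-⅓ {v} {x} {y} v~x v~y x≢y x≁y with c x ≟ c v | c y ≟ c v
  ... | no x∉P  | _       = u-≤-⅓ v refl v~x x∉P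
  ... | yes _   | no y∉P  = u-≤-⅓ v refl v~y y∉P
  ... | yes x∈P | yes y∈P = ≤-trans (u-≤-5/16 v x∈P y∈P x≢y x≁y) 5/16≤1/3

  tip-≤-⅓ : ∀ {v a y} → adj G v a ≡ true → adj G a y ≡ true → v ≢ y → adj G v y ≡ false → u G c v ≤ + 1 / 3
  tip-≤-⅓ {v} {a} {y} v~a a~y v≢y v≁y with c a ≟ c v | c y ≟ c v
  ... | no a∉P  | _       = u-≤-⅓ v refl v~a a∉P
  ... | yes _   | yes y∈P = ≤-trans (u-≤-5/16 v refl y∈P v≢y v≁y) 5/16≤1/3
  ... | yes a∈P | no y∉P  = u-≤-⅓ v a∈P a~y y∉P

  diamond-bound : ∀ {a b x y} → Diamond G a b x y → u G c a + u G c b + u G c x + u G c y ≤ + 5 / 4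
  diamond-bound {a} {b} {x} {y} (diamond a~b a~x a~y b~x b~y x≁y x≢y) =
    cases (c a ≟ c b) (c x ≟ c a) (c y ≟ c a)
    where
    ha = hub-≤-⅓ a~x a~y x≢y x≁y
    hb = hub-≤-⅓ b~x b~y x≢y x≁y
    tx = tip-≤-⅓ (adj-flip G a~x) a~y x≢y x≁y
    ty = tip-≤-⅓ (adj-flip G a~y) a~x (x≢y ∘ sym) (adj-flip G x≁y)
    cases : Dec (c a ≡ c b) → Dec (c x ≡ c a) → Dec (c y ≡ c a) →
            u G c a + u G c b + u G c x + u G c y ≤ + 5 / 4
    cases (yes a≈b) (no x∉)  _        = +-mono₄-≤ ha hb
      (u-≤-¼ x refl (adj-≢ G a~b) (adj-flip G a~x) (adj-flip G b~x) (x∉ ∘ sym)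
             (λ e → x∉ (trans (sym e) (sym a≈b))))
      ty
    cases (yes a≈b) (yes _)  (no y∉)  = +-mono₄-≤ ha hb tx
      (u-≤-¼ y refl (adj-≢ G a~b) (adj-flip G a~y) (adj-flip G b~y) (y∉ ∘ sym)
             (λ e → y∉ (trans (sym e) (sym a≈b))))
    cases (yes a≈b) (yes x∈) (yes y∈) = +-mono₄-≤
      (u-≤-5/16 a x∈ y∈ x≢y x≁y) (u-≤-5/16 b (trans x∈ a≈b) (trans y∈ a≈b) x≢y x≁y)
      (u-≤-5/16 x refl (trans y∈ (sym x∈)) x≢y x≁y) (u-≤-5/16 y (trans x∈ (sym y∈)) refl x≢y x≁y)
    cases (no a≉b)  (no x∉)  _        = +-mono₄-≤
      (u-≤-¼ a refl (adj-≢ G b~x) a~b a~x (a≉b ∘ sym) x∉) hb tx ty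
    cases (no a≉b)  (yes _)  (no y∉)  = +-mono₄-≤
      (u-≤-¼ a refl (adj-≢ G b~y) a~b a~y (a≉b ∘ sym) y∉) hb tx ty
    cases (no a≉b)  (yes x∈) (yes _)  = +-mono₄-≤ ha
      (u-≤-¼ b refl (adj-≢ G a~x) (adj-flip G a~b) b~x a≉b (λ e → a≉b (trans (sym x∈) e))) tx ty

  diamond-sum : ∀ {v₁ v₂ v₃ v₄} → DiamondLabelling G v₁ v₂ v₃ v₄ →
                u G c v₁ + u G c v₂ + u G c v₃ + u G c v₄ ≤ + 5 / 4
  diamond-sum {v₁} {v₂} {v₃} {v₄} (tips₁₂ d) =
    subst (_≤ + 5 / 4) (abxy≡xyab (u G c v₃) (u G c v₄) (u G c v₁) (u G c v₂)) (diamond-bound d)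
  diamond-sum {v₁} {v₂} {v₃} {v₄} (tips₁₃ d) =
    subst (_≤ + 5 / 4) (abxy≡xayb (u G c v₂) (u G c v₄) (u G c v₁) (u G c v₃)) (diamond-bound d)
  diamond-sum {v₁} {v₂} {v₃} {v₄} (tips₁₄ d) =
    subst (_≤ + 5 / 4) (abxy≡xaby (u G c v₂) (u G c v₃) (u G c v₁) (u G c v₄)) (diamond-bound d)
  diamond-sum {v₁} {v₂} {v₃} {v₄} (tips₂₃ d) =
    subst (_≤ + 5 / 4) (abxy≡axyb (u G c v₁) (u G c v₄) (u G c v₂) (u G c v₃)) (diamond-bound d)
  diamond-sum {v₁} {v₂} {v₃} {v₄} (tips₂₄ d) =
    subst (_≤ + 5 / 4) (abxy≡axby (u G c v₁) (u G c v₃) (u G c v₂) (u G c v₄)) (diamond-bound d)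
  diamond-sum (tips₃₄ d) = diamond-bound d

lemma9 : (n : ℕ) (G : Graph n) → Cubic G → (∀ v → ¬ ComponentIsK4 G v) →
         (v1 v2 v3 v4 : Fin n) → InducesDiamond G v1 v2 v3 v4 →
         (c : Fin n → Fin n) →
         u G c v1 + u G c v2 + u G c v3 + u G c v4 ≤ (+ 5) / 4
lemma9 n G cubic _ v1 v2 v3 v4 induced c = diamond-sum cubic c (diamond-labelling G induced)
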